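{- Let $R$ be an oriented ray with an unbounded representing sequence. Then for all distinct vertices $v\neq w$ of $R$, the tails $vR$ and $wR$ are not isomorphic (as digraphs).
   Context: An oriented ray is a digraph whose underlying undirected graph is a ray (one-way infinite path) with first vertex the unique vertex of undirected degree $1$. An arc is in-oriented if it points towards the first vertex and out-oriented otherwise. A phase is a maximal consistently directed path (dipath) contained in the ray; its length is its number of arcs. For an oriented ray with infinitely many in-oriented and infinitely many out-oriented arcs, its representing sequence is the sequence whose $n$-th term is the length of the $n$-th phase, counted from the first vertex; it is unbounded if no $b\in\mathbb N$ bounds all its terms. For $v\in R$, $vR$ denotes the tail of $R$ starting at $v$. -}

module Defs where

open import Data.Nat using (ℕ; zero; suc; _+_; _≤_; _<_)
open import Data.Bool using (Bool; true; false)
open import Data.Product using (Σ; ∃; ∃-syntax; _×_; _,_)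
open import Data.Sum using (_⊎_)
open import Relation.Binary.PropositionalEquality using (_≡_; _≢_)
open import Function.Bundles using (_↔_; Inverse)

-- An oriented ray: vertices are ℕ (vertex 0 is the first vertex), and the
-- underlying ray has edges {i, i+1}.  The orientation o i of the i-th edge is
--   true  : out-oriented, arc i → i+1 (pointing away from the first vertex)
--   false : in-oriented,  arc i+1 → i (pointing towards the first vertex)
OrientedRay : Set
OrientedRay = ℕ → Bool

Arc : OrientedRay → ℕ → ℕ → Set
Arc o i j = (j ≡ suc i × o i ≡ true) ⊎ (i ≡ suc j × o j ≡ false)

InfinitelyMany : OrientedRay → Bool → Set
InfinitelyMany o b = ∀ m → ∃[ i ] (m ≤ i × o i ≡ b)

-- A phase: a maximal consistently directed path, consisting of the edges
-- s, s+1, …, s+l-1 (length l ≥ 1).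
IsPhase : OrientedRay → ℕ → ℕ → Set
IsPhase o s l =
  (0 < l) ×
  (∀ k → k < l → o (s + k) ≡ o s) ×
  (o (s + l) ≢ o s) ×
  (∀ t → s ≡ suc t → o t ≢ o s)

-- PhaseStart o n s : the n-th phase (counted from 0, from the first vertex)
-- starts at edge s.
data PhaseStart (o : OrientedRay) : ℕ → ℕ → Set where
  first : PhaseStart o 0 0
  next  : ∀ {n s l} → PhaseStart o n s → IsPhase o s l → PhaseStart o (suc n) (s + l)

RepSeq : OrientedRay → ℕ → ℕ → Set
RepSeq o n l = ∃[ s ] (PhaseStart o n s × IsPhase o s l)

UnboundedRepSeq : OrientedRay → Set
UnboundedRepSeq o = ∀ b → ∃[ n ] ∃[ l ] (RepSeq o n l × b < l)

-- The tail vR, with vertex v renamed to 0 (vertex v + k ↦ k).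
Tail : OrientedRay → ℕ → OrientedRay
Tail o v k = o (v + k)

Isomorphic : OrientedRay → OrientedRay → Set
Isomorphic o o' = Σ (ℕ ↔ ℕ) λ f →
  ∀ i j → (Arc o i j → Arc o' (Inverse.to f i) (Inverse.to f j)) ×
          (Arc o' (Inverse.to f i) (Inverse.to f j) → Arc o i j)

{-# OPTIONS --safe #-}
module Submission where

-- An isomorphism between the digraphs of two oriented rays is in particular an
-- automorphism of the underlying path on ℕ, hence the identity, so isomorphic
-- oriented rays have the same orientation.  If vR ≅ wR with v < w, then o is
-- therefore periodic from v on with period p = w − v.  A phase of length
-- greater than v + p contains a window of p consecutive arcs at or after v,
-- and periodicity makes o constant from that window on, contradicting that
-- both orientations occur infinitely often.  So all phases are bounded.

open import Defs
open import Data.Nat using (ℕ; zero; suc; _+_; _*_; _∸_; _≤_; _<_; NonZero; >-nonZero)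
open import Data.Nat.Properties
open import Data.Nat.DivMod using (_%_; _/_; m≡m%n+[m/n]*n; m%n<n)
open import Data.Bool using (Bool; true; false; not)
open import Data.Bool.Properties using (not-¬)
open import Data.Product using (_×_; _,_; proj₁; proj₂)
open import Data.Sum using (_⊎_; inj₁; inj₂)
open import Data.Empty using (⊥-elim)
open import Relation.Binary.PropositionalEquality
open import Relation.Binary.Definitions using (tri<; tri≈; tri>)
open import Relation.Nullary using (¬_)
open import Function.Bundles using (_↔_; Inverse)

private
  variable
    o o' : OrientedRay
    i j k s t v l p : ℕ
    b : Bool

Consecutive : ℕ → ℕ → Set
Consecutive i j = j ≡ suc i ⊎ i ≡ suc j

Adjacent : OrientedRay → ℕ → ℕ → Set
Adjacent o i j = Arc o i j ⊎ Arc o j i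

arc⇒consecutive : Arc o i j → Consecutive i j
arc⇒consecutive (inj₁ (j≡1+i , _)) = inj₁ j≡1+i
arc⇒consecutive (inj₂ (i≡1+j , _)) = inj₂ i≡1+j

adjacent⇒consecutive : Adjacent o i j → Consecutive i j
adjacent⇒consecutive (inj₁ arc) = arc⇒consecutive arc
adjacent⇒consecutive (inj₂ arc) with arc⇒consecutive arc
... | inj₁ i≡1+j = inj₂ i≡1+j
... | inj₂ j≡1+i = inj₁ j≡1+i

adjacent-suc : ∀ o i → Adjacent o i (suc i)
adjacent-suc o i = by-orientation (o i) refl
  where
  by-orientation : ∀ b → o i ≡ b → Adjacent o i (suc i)
  by-orientation true  oi = inj₁ (inj₁ (refl , oi))
  by-orientation false oi = inj₂ (inj₂ (refl , oi))

consecutive⇒adjacent : ∀ o → Consecutive i j → Adjacent o i j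
consecutive⇒adjacent {i} o (inj₁ refl) = adjacent-suc o i
consecutive⇒adjacent {j = j} o (inj₂ refl) with adjacent-suc o j
... | inj₁ arc = inj₂ arc
... | inj₂ arc = inj₁ arc

arc-suc⇒out : ∀ o → Arc o k (suc k) → o k ≡ true
arc-suc⇒out o (inj₁ (_ , ok)) = ok
arc-suc⇒out o (inj₂ (k≡2+k , _)) = ⊥-elim (m+1+n≢n 1 (sym k≡2+k))

out⇒arc-suc : ∀ o → o k ≡ true → Arc o k (suc k)
out⇒arc-suc o ok = inj₁ (refl , ok)

consecutive-zero : Consecutive i 0 → i ≡ 1
consecutive-zero (inj₂ i≡1) = i≡1

consecutive-of-zero : Consecutive 0 i → i ≡ 1
consecutive-of-zero (inj₁ i≡1) = i≡1

module PathAutomorphism (F : ℕ ↔ ℕ)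
  (preserves : ∀ {i j} → Consecutive i j → Consecutive (Inverse.to F i) (Inverse.to F j))
  (reflects  : ∀ {i j} → Consecutive (Inverse.to F i) (Inverse.to F j) → Consecutive i j)
  where

  open Inverse F using (to; from; strictlyInverseˡ; strictlyInverseʳ)

  to-injective : to i ≡ to j → i ≡ j
  to-injective {i} {j} eq =
    trans (sym (strictlyInverseʳ i)) (trans (cong from eq) (strictlyInverseʳ j))

  -- If to 0 = 1 + m, then m and 2 + m are neighbours of to 0, so their
  -- preimages are neighbours of 0; both would be 1.
  to-zero : to 0 ≡ 0
  to-zero with to 0 in to0
  ... | zero  = refl
  ... | suc m = ⊥-elim (m+1+n≢n 1 (trans (sym (image-of-one above)) (image-of-one below)))
    where
    below : Consecutive (to (from m)) (to 0)
    below = inj₁ (trans to0 (cong suc (sym (strictlyInverseˡ m))))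

    above : Consecutive (to (from (suc (suc m)))) (to 0)
    above = inj₂ (trans (strictlyInverseˡ _) (cong suc (sym to0)))

    image-of-one : ∀ {y} → Consecutive (to (from y)) (to 0) → to 1 ≡ y
    image-of-one {y} c =
      trans (cong to (sym (consecutive-zero (reflects c)))) (strictlyInverseˡ y)

  to-one : to 1 ≡ 1
  to-one = consecutive-of-zero (subst (λ x → Consecutive x (to 1)) to-zero (preserves (inj₁ refl)))

  to-fixes-pair : ∀ n → to n ≡ n × to (suc n) ≡ suc n
  to-fixes-pair zero = to-zero , to-one
  to-fixes-pair (suc n) with to-fixes-pair n
  ... | to-n , to-1+n with preserves {suc n} {suc (suc n)} (inj₁ refl)
  ... | inj₁ to-2+n = to-1+n , trans to-2+n (cong suc to-1+n)
  ... | inj₂ 1+to-2+n = ⊥-elim (m+1+n≢n 1 (to-injective (trans to-2+n≡n (sym to-n))))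
    where
    to-2+n≡n : to (suc (suc n)) ≡ n
    to-2+n≡n = sym (suc-injective (trans (sym to-1+n) 1+to-2+n))

  to-id : ∀ n → to n ≡ n
  to-id n = proj₁ (to-fixes-pair n)

isomorphic⇒same-orientation : Isomorphic o o' → ∀ k → o k ≡ o' k
isomorphic⇒same-orientation {o} {o'} (F , arcs) k = same (o k) (o' k) refl refl
  where
  open Inverse F using (to)

  adjacency-preserved : Adjacent o i j → Adjacent o' (to i) (to j)
  adjacency-preserved {i} {j} (inj₁ arc) = inj₁ (proj₁ (arcs i j) arc)
  adjacency-preserved {i} {j} (inj₂ arc) = inj₂ (proj₁ (arcs j i) arc)

  adjacency-reflected : Adjacent o' (to i) (to j) → Adjacent o i j
  adjacency-reflected {i} {j} (inj₁ arc) = inj₁ (proj₂ (arcs i j) arc)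
  adjacency-reflected {i} {j} (inj₂ arc) = inj₂ (proj₂ (arcs j i) arc)

  open PathAutomorphism F
    (λ c → adjacent⇒consecutive {o = o'} (adjacency-preserved (consecutive⇒adjacent o c)))
    (λ c → adjacent⇒consecutive {o = o} (adjacency-reflected (consecutive⇒adjacent o' c)))

  out-preserved : o k ≡ true → o' k ≡ true
  out-preserved ok = arc-suc⇒out o'
    (subst₂ (Arc o') (to-id k) (to-id (suc k)) (proj₁ (arcs k (suc k)) (out⇒arc-suc o ok)))

  out-reflected : o' k ≡ true → o k ≡ true
  out-reflected ok = arc-suc⇒out o (proj₂ (arcs k (suc k))
    (subst₂ (Arc o') (sym (to-id k)) (sym (to-id (suc k))) (out⇒arc-suc o' ok)))

  same : ∀ a a' → o k ≡ a → o' k ≡ a' → a ≡ a'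
  same true  _     ok o'k = trans (sym (out-preserved ok)) o'k
  same false false _  _   = refl
  same false true  ok o'k = trans (sym ok) (out-reflected o'k)

PeriodicFrom : ℕ → ℕ → OrientedRay → Set
PeriodicFrom v p o = ∀ t → v ≤ t → o t ≡ o (p + t)

periodicFrom-iterate : PeriodicFrom v p o → v ≤ t → ∀ m → o t ≡ o (m * p + t)
periodicFrom-iterate per v≤t zero = refl
periodicFrom-iterate {v} {p} {o} {t} per v≤t (suc m) = begin
  o t                ≡⟨ periodicFrom-iterate per v≤t m ⟩
  o (m * p + t)      ≡⟨ per (m * p + t) (≤-trans v≤t (m≤n+m t (m * p))) ⟩
  o (p + (m * p + t)) ≡⟨ cong o (sym (+-assoc p (m * p) t)) ⟩
  o (p + m * p + t)  ∎
  where open ≡-Reasoning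

-- Writing k = k % p + (k / p) * p reduces every position to one in the window.
periodicFrom-window⇒constant : .{{_ : NonZero p}} → PeriodicFrom v p o → v ≤ t →
  (∀ r → r < p → o (t + r) ≡ b) → ∀ k → o (t + k) ≡ b
periodicFrom-window⇒constant {p = p} {o = o} {t = t} {b = b} per v≤t window k = begin
  o (t + k)                      ≡⟨ cong (λ x → o (t + x)) (m≡m%n+[m/n]*n k p) ⟩
  o (t + (k % p + (k / p) * p))  ≡⟨ cong o (rearrange t (k % p) ((k / p) * p)) ⟩
  o ((k / p) * p + (t + k % p))  ≡⟨ sym (periodicFrom-iterate per (≤-trans v≤t (m≤m+n t _)) (k / p)) ⟩
  o (t + k % p)                  ≡⟨ window (k % p) (m%n<n k p) ⟩
  b                              ∎
  where
  open ≡-Reasoning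
  rearrange : ∀ x y z → x + (y + z) ≡ z + (x + y)
  rearrange x y z = trans (sym (+-assoc x y z)) (+-comm (x + y) z)

¬eventually-constant : InfinitelyMany o (not b) → ¬ (∀ k → o (t + k) ≡ b)
¬eventually-constant {o} {b} {t} infinitely constant with infinitely t
... | i , t≤i , oi = not-¬ refl (trans (sym (constant (i ∸ t))) (trans (cong o (m+[n∸m]≡n t≤i)) oi))

infinitely-both⇒¬eventually-constant : InfinitelyMany o true → InfinitelyMany o false →
  ¬ (∀ k → o (t + k) ≡ b)
infinitely-both⇒¬eventually-constant {b = true}  _    ifalse = ¬eventually-constant ifalse
infinitely-both⇒¬eventually-constant {b = false} itrue _      = ¬eventually-constant itrue

periodicFrom⇒phase-bounded : .{{_ : NonZero p}} → PeriodicFrom v p o →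
  InfinitelyMany o true → InfinitelyMany o false → IsPhase o s l → ¬ (v + p < l)
periodicFrom⇒phase-bounded {p} {v} {o} {s} per itrue ifalse (_ , in-phase , _ , _) v+p<l =
  infinitely-both⇒¬eventually-constant itrue ifalse
    (periodicFrom-window⇒constant per (m≤n+m v s) window)
  where
  window : ∀ r → r < p → o (s + v + r) ≡ o s
  window r r<p = trans (cong o (+-assoc s v r))
    (in-phase (v + r) (<-trans (+-monoʳ-< v r<p) v+p<l))

periodicFrom⇒¬unbounded : .{{_ : NonZero p}} → PeriodicFrom v p o →
  InfinitelyMany o true → InfinitelyMany o false → ¬ UnboundedRepSeq o
periodicFrom⇒¬unbounded {p} {v} per itrue ifalse unbounded with unbounded (v + p)
... | _ , _ , (_ , _ , phase) , v+p<l = periodicFrom⇒phase-bounded per itrue ifalse phase v+p<l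

equal-tails⇒periodicFrom : v < t → (∀ k → o (v + k) ≡ o (t + k)) → PeriodicFrom v (t ∸ v) o
equal-tails⇒periodicFrom {v = v} {t = t} {o = o} v<t equal u v≤u = begin
  o u                       ≡⟨ cong o (sym (m+[n∸m]≡n v≤u)) ⟩
  o (v + (u ∸ v))           ≡⟨ equal (u ∸ v) ⟩
  o (t + (u ∸ v))           ≡⟨ cong (λ x → o (x + (u ∸ v))) (sym (m∸n+n≡m (<⇒≤ v<t))) ⟩
  o (t ∸ v + v + (u ∸ v))   ≡⟨ cong o (+-assoc (t ∸ v) v (u ∸ v)) ⟩
  o (t ∸ v + (v + (u ∸ v))) ≡⟨ cong (λ x → o (t ∸ v + x)) (m+[n∸m]≡n v≤u) ⟩
  o (t ∸ v + u)             ∎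
  where open ≡-Reasoning

equal-tails⇒¬unbounded : InfinitelyMany o true → InfinitelyMany o false →
  v < t → (∀ k → o (v + k) ≡ o (t + k)) → ¬ UnboundedRepSeq o
equal-tails⇒¬unbounded itrue ifalse v<t equal =
  periodicFrom⇒¬unbounded {{>-nonZero (m<n⇒0<n∸m v<t)}}
    (equal-tails⇒periodicFrom v<t equal) itrue ifalse

lemma4p3 : (o : OrientedRay) → InfinitelyMany o true → InfinitelyMany o false →
    UnboundedRepSeq o → (v w : ℕ) → v ≢ w → ¬ Isomorphic (Tail o v) (Tail o w)
lemma4p3 o itrue ifalse unbounded v w v≢w iso with <-cmp v w
... | tri< v<w _ _ = equal-tails⇒¬unbounded itrue ifalse v<w equal unbounded
  where
  equal : ∀ k → o (v + k) ≡ o (w + k)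
  equal = isomorphic⇒same-orientation iso
... | tri≈ _ v≡w _ = v≢w v≡w
... | tri> _ _ w<v = equal-tails⇒¬unbounded itrue ifalse w<v equal unbounded
  where
  equal : ∀ k → o (w + k) ≡ o (v + k)
  equal k = sym (isomorphic⇒same-orientation iso k)
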